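{- Let $\mathcal{K}=\mathbb{F}_q((x^{ -1}))$, $\mathcal{R}=\mathbb{F}_q[x]$, $1\le k\le n$, $m\ge1$, $\boldsymbol{\mu}=(\mu_1,\dots,\mu_m)\in(q^{\mathbb{Z}})^m$ with $\mu_1<\cdots<\mu_m$, $\boldsymbol{s}\in\mathbb{N}^m$, and let $\Lambda\le\mathcal{K}^n$ be a $(\boldsymbol{\mu},\boldsymbol{s})$-sublattice of dimension $k$ with successive minima $\lambda_i=\lambda_i(\Lambda)$. Fix an $\mathcal{R}$-basis $\mathbf{v}_1,\dots,\mathbf{v}_k$ of $\Lambda$ with $\Vert\mathbf{v}_i\Vert=\lambda_i$ for all $i$. For $1\le\ell\le m$ let $I_\ell=\{j\in\{1,\dots,k\}:\lambda_j=\mu_\ell\}$. Let $\mathbf{u}_j=\sum_{i=1}^k a_{i,j}\mathbf{v}_i$ with $a_{i,j}\in\mathcal{R}$, $1\le j\le k$, and suppose: \begin{enumerate} \item $|a_{i,j}|\le1$ for all $i,j\in I_\ell$, $1\le\ell\le m$; \item $|a_{i,j}|\le\frac{\mu_\ell}{\mu_{\ell'}}$ for all $i\in I_{\ell'}$, $j\in I_\ell$ with $1\le\ell'<\ell\le m$; \item $a_{i,j}=0$ for all $i\in I_{\ell'}$, $j\in I_\ell$ with $1\le\ell<\ell'\le m$; \item for every $1\le\ell\le m$, the matrix $(a_{i,j})_{i,j\in I_\ell}$ (which has entries in $\mathbb{F}_q$) is invertible over $\mathbb{F}_q$. \end{enumerate} Then $(\mathbf{u}_1,\dots,\mathbf{u}_k)$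 is an $\mathcal{R}$-basis of $\Lambda$ with $\Vert\mathbf{u}_j\Vert=\lambda_j$ for all $1\le j\le k$ (i.e. a basis of successive minima of $\Lambda$).
   Context: On $\mathcal{K}$ the absolute value is $|\sum_ia_ix^{ -i}|=q^{ -\min\{i:a_i\ne0\}}$ (so $|f|=q^{\deg f}$ for nonzero $f\in\mathcal{R}$), and $\mathcal{K}^n$ carries the norm $\Vert\mathbf{v}\Vert=\max_i|v_i|$. A $k$-sublattice is a subgroup $\Lambda=\mathcal{R}\mathbf{w}_1\oplus\cdots\oplus\mathcal{R}\mathbf{w}_k$ with $\mathbf{w}_i\in\mathcal{K}^n$ linearly independent over $\mathcal{K}$. Its successive minima are $\lambda_i(\Lambda)=\inf\{r>0:\dim\operatorname{span}_{\mathcal{K}}(\Lambda\cap\{\mathbf{v}:\Vert\mathbf{v}\Vert\le r\})\ge i\}$. $\Lambda$ is a $(\boldsymbol{\mu},\boldsymbol{s})$-sublattice if $\{\lambda_1(\Lambda),\dots,\lambda_k(\Lambda)\}=\{\mu_1,\dots,\mu_m\}$ and $|\{i:\lambda_i(\Lambda)=\mu_j\}|=s_j$ for each $j$. -}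

module Defs where

open import Level using (0ℓ)
open import Algebra.Bundles using (CommutativeRing)
open import Data.Nat as ℕ using (ℕ; zero; suc)
open import Data.Integer as ℤ using (ℤ; +_; 0ℤ; 1ℤ)
import Data.Integer.Properties as ℤP
open import Data.Fin as Fin using (Fin; toℕ)
open import Data.Fin.Properties as FinP using ()
open import Data.Bool using (Bool; true; false; if_then_else_; T)
open import Data.Product using (Σ; _×_; _,_)
open import Relation.Nullary using (¬_; Dec; yes; no; does)
open import Relation.Binary.PropositionalEquality using (_≡_)

record FiniteField : Set₁ where
  field
    cring : CommutativeRing 0ℓ 0ℓ
  open CommutativeRing cring public
  field
    1≉0       : ¬ (1# ≈ 0#)
    inverse   : ∀ x → ¬ (x ≈ 0#) → Σ Carrier λ y → (x * y) ≈ 1#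
    q         : ℕ
    enum      : Fin q → Carrier
    enum-surj : ∀ x → Σ (Fin q) λ t → enum t ≈ x
    enum-inj  : ∀ s t → enum s ≈ enum t → s ≡ t

module LS (F : FiniteField) where
  open FiniteField F using (Carrier; 0#; 1#)
    renaming (_≈_ to _≈F_; _+_ to _+F_; _*_ to _*F_)
  private module FF = FiniteField F

  sumF : ∀ {k} → (Fin k → Carrier) → Carrier
  sumF {zero}  f = 0#
  sumF {suc k} f = f Fin.zero +F sumF (λ i → f (Fin.suc i))

  sumN : ℕ → (ℕ → Carrier) → Carrier
  sumN zero    f = 0#
  sumN (suc l) f = f zero +F sumN l (λ t → f (suc t))

  -- An element of K = F((x⁻¹)) is Σ_d coeff d · x^d with coeff d = 0 for
  -- all d > top (i.e. finitely many positive powers of x).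
  record K : Set where
    constructor mkK
    field
      top    : ℕ
      coeff  : ℤ → Carrier
      vanish : ∀ d → (+ top) ℤ.< d → coeff d ≈F 0#
  open K public

  infix 4 _≈K_
  _≈K_ : K → K → Set
  f ≈K g = ∀ d → coeff f d ≈F coeff g d

  0K : K
  0K = mkK 0 (λ _ → 0#) (λ _ _ → FF.refl)

  _+K_ : K → K → K
  f +K g = mkK (top f ℕ.⊔ top g) (λ d → coeff f d +F coeff g d) pf
    where
    pf : ∀ d → (+ (top f ℕ.⊔ top g)) ℤ.< d → (coeff f d +F coeff g d) ≈F 0#
    pf d lt = FF.trans
      (FF.+-cong (vanish f d (ℤP.≤-<-trans (ℤ.+≤+ (Data.Nat.Properties.m≤m⊔n (top f) (top g))) lt))
                 (vanish g d (ℤP.≤-<-trans (ℤ.+≤+ (Data.Nat.Properties.m≤n⊔m (top f) (top g))) lt)))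
      (FF.+-identityˡ 0#)
      where import Data.Nat.Properties

  -- Cauchy product: coefficient of x^n is Σ_{n-M ≤ d ≤ N} f_d g_{n-d}
  -- (all other terms vanish), where N = top f, M = top g.
  mulCoeff : K → K → ℤ → Carrier
  mulCoeff f g n with n ℤP.≤? (+ (top f ℕ.+ top g))
  ... | yes _ = sumN (suc ℤ.∣ (+ (top f ℕ.+ top g)) ℤ.- n ∣)
                     (λ t → coeff f ((n ℤ.- (+ top g)) ℤ.+ (+ t))
                            *F coeff g (n ℤ.- ((n ℤ.- (+ top g)) ℤ.+ (+ t))))
  ... | no  _ = 0#

  mulVanish : ∀ f g d → (+ (top f ℕ.+ top g)) ℤ.< d → mulCoeff f g d ≈F 0#
  mulVanish f g d lt with d ℤP.≤? (+ (top f ℕ.+ top g))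
  ... | yes le = ⊥-elim (ℤP.<⇒≱ lt le)
    where open import Data.Empty using (⊥-elim)
  ... | no  _  = FF.refl

  _*K_ : K → K → K
  f *K g = mkK (top f ℕ.+ top g) (mulCoeff f g) (mulVanish f g)

  sumK : ∀ {k} → (Fin k → K) → K
  sumK {zero}  f = 0K
  sumK {suc k} f = f Fin.zero +K sumK (λ i → f (Fin.suc i))

  Vec : ℕ → Set
  Vec n = Fin n → K

  lin : ∀ {n k} → (Fin k → K) → (Fin k → Vec n) → Vec n
  lin c w coord = sumK (λ i → c i *K w i coord)

  VEq : ∀ {n} → Vec n → Vec n → Set
  VEq v v' = ∀ coord → v coord ≈K v' coord

  VZero : ∀ {n} → Vec n → Set
  VZero v = ∀ coord → v coord ≈K 0K

  IsPoly : K → Set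
  IsPoly f = ∀ d → d ℤ.< 0ℤ → coeff f d ≈F 0#

  -- |f| ≤ q^e
  AbsLe : K → ℤ → Set
  AbsLe f e = ∀ d → e ℤ.< d → coeff f d ≈F 0#

  NormLe : ∀ {n} → Vec n → ℤ → Set
  NormLe v e = ∀ coord → AbsLe (v coord) e

  NormEq : ∀ {n} → Vec n → ℤ → Set
  NormEq v e = NormLe v e × ¬ NormLe v (e ℤ.- 1ℤ)

  LinIndepK : ∀ {n k} → (Fin k → Vec n) → Set
  LinIndepK w = ∀ c → VZero (lin c w) → ∀ i → c i ≈K 0K

  LinIndepR : ∀ {n k} → (Fin k → Vec n) → Set
  LinIndepR w = ∀ c → (∀ i → IsPoly (c i)) → VZero (lin c w) → ∀ i → c i ≈K 0K

  InLat : ∀ {n k} → (Fin k → Vec n) → Vec n → Set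
  InLat w v = Σ (Fin _ → K) λ c → (∀ i → IsPoly (c i)) × VEq v (lin c w)

  IsRBasis : ∀ {n k k'} → (Fin k → Vec n) → (Fin k' → Vec n) → Set
  IsRBasis w u = (∀ j → InLat w (u j))
               × (∀ v → InLat w v → InLat u v)
               × LinIndepR u

  IndepInBall : ∀ {n k} → (Fin k → Vec n) → ℕ → ℤ → Set
  IndepInBall {n} w r e =
    Σ (Fin r → Vec n) λ z → (∀ t → InLat w (z t)) × LinIndepK z × (∀ t → NormLe (z t) e)

  -- λ_{i+1}(Λ) = q^e (i : Fin k is 0-based). Since the norm takes values
  -- in q^ℤ ∪ {0}, the infimum defining λ_{i+1} equals q^e iff the ball of
  -- radius q^e works and the ball of radius q^(e-1) does not.
  IsSuccMin : ∀ {n k} → (Fin k → Vec n) → Fin k → ℤ → Set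
  IsSuccMin w i e = IndepInBall w (suc (toℕ i)) e × ¬ IndepInBall w (suc (toℕ i)) (e ℤ.- 1ℤ)

  count : ∀ {k} → (Fin k → Bool) → ℕ
  count {zero}  P = 0
  count {suc k} P = (if P Fin.zero then 1 else 0) ℕ.+ count (λ i → P (Fin.suc i))

  InI : ∀ {k m} → (Fin k → ℤ) → (Fin m → ℤ) → Fin m → Fin k → Bool
  InI lam e ℓ j = does (lam j ℤ.≟ e ℓ)

  -- (μ,s)-sublattice condition, with μ_j = q^(e j), λ_i = q^(lam i)
  IsMuS : ∀ {k m} → (Fin k → ℤ) → (Fin m → ℤ) → (Fin m → ℕ) → Set
  IsMuS {k} {m} lam e s =
      (∀ i → Σ (Fin m) λ j → lam i ≡ e j)
    × (∀ j → Σ (Fin k) λ i → lam i ≡ e j)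
    × (∀ j → count (InI lam e j) ≡ s j)

  δ : ∀ {k} → Fin k → Fin k → Carrier
  δ i j = if does (i Fin.≟ j) then 1# else 0#

  sumOn : ∀ {k} → (Fin k → Bool) → (Fin k → Carrier) → Carrier
  sumOn P f = sumF (λ t → if P t then f t else 0#)

  InvertibleOn : ∀ {k} → (Fin k → Bool) → (Fin k → Fin k → Carrier) → Set
  InvertibleOn {k} P A =
    Σ (Fin k → Fin k → Carrier) λ B → ∀ i j → T (P i) → T (P j) →
        (sumOn P (λ t → A i t *F B t j) ≈F δ i j)
      × (sumOn P (λ t → B i t *F A t j) ≈F δ i j)

  const : K → Carrier
  const f = coeff f 0ℤ

  Cond1 : ∀ {k m} → (Fin k → ℤ) → (Fin m → ℤ) → (Fin k → Fin k → K) → Set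
  Cond1 lam e a = ∀ ℓ i j → lam i ≡ e ℓ → lam j ≡ e ℓ → AbsLe (a i j) 0ℤ

  Cond2 : ∀ {k m} → (Fin k → ℤ) → (Fin m → ℤ) → (Fin k → Fin k → K) → Set
  Cond2 lam e a = ∀ ℓ' ℓ → ℓ' Fin.< ℓ → ∀ i j → lam i ≡ e ℓ' → lam j ≡ e ℓ →
                  AbsLe (a i j) (e ℓ ℤ.- e ℓ')

  Cond3 : ∀ {k m} → (Fin k → ℤ) → (Fin m → ℤ) → (Fin k → Fin k → K) → Set
  Cond3 lam e a = ∀ ℓ ℓ' → ℓ Fin.< ℓ' → ∀ i j → lam i ≡ e ℓ' → lam j ≡ e ℓ →
                  a i j ≈K 0K

  Cond4 : ∀ {k m} → (Fin k → ℤ) → (Fin m → ℤ) → (Fin k → Fin k → K) → Set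
  Cond4 lam e a = ∀ ℓ → InvertibleOn (InI lam e ℓ) (λ i j → const (a i j))

-- Write u = v a.  Grouping indices into the blocks I_ℓ of equal successive minima, a is block upper
-- triangular (condition 3) with constant invertible diagonal blocks (conditions 1 and 4).  Multiplying by
-- the block-diagonal inverse of these blocks gives a block unitriangular matrix, so a is injective over K
-- (u is K-independent) and, by induction over the blocks, every v_i is an R-combination of the u_j; hence
-- u is an R-basis of Λ.  Conditions 1–3 bound ‖u_j‖ ≤ λ_j, and equality holds because the u_j are
-- independent lattice vectors.

module Submission where

open import Level using (0ℓ)
open import Algebra.Bundles using (CommutativeRing; Semiring)
open import Algebra.Structures using (IsCommutativeRing)
open import Data.Bool using (Bool; true; false; if_then_else_; T)
open import Data.Empty using (⊥-elim)
open import Data.Fin as Fin using (Fin; toℕ)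
import Data.Fin.Properties as FinP
open import Data.Integer as ℤ using (ℤ; _<_; +_; -[1+_]; 0ℤ; 1ℤ)
import Data.Integer.Properties as ℤP
open import Data.Nat as ℕ using (ℕ; _≤_; zero; suc)
import Data.Nat.Properties as ℕP
open import Data.Product using (Σ; _×_; _,_; proj₁; proj₂)
open import Data.Sum using (_⊎_; inj₁; inj₂)
open import Data.Unit using (tt)
open import Function using (_∘_)
open import Relation.Binary using (tri<; tri≈; tri>)
open import Relation.Binary.PropositionalEquality as ≡ using (_≡_; _≢_)
open import Relation.Nullary using (¬_; yes; no; does)

open import Defs

module Convolution (F : FiniteField) where
  open FiniteField F hiding (zero)
  open LS F using (sumN)
  open import Relation.Binary.Reasoning.Setoid setoid

  sumN-cong : ∀ L {f g : ℕ → Carrier} → (∀ t → t ℕ.< L → f t ≈ g t) → sumN L f ≈ sumN L g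
  sumN-cong zero    f≈g = refl
  sumN-cong (suc L) f≈g =
    +-cong (f≈g 0 (ℕ.s≤s ℕ.z≤n)) (sumN-cong L (λ t t<L → f≈g (suc t) (ℕ.s≤s t<L)))

  sumN-zero : ∀ L {f : ℕ → Carrier} → (∀ t → t ℕ.< L → f t ≈ 0#) → sumN L f ≈ 0#
  sumN-zero zero    f≈0 = refl
  sumN-zero (suc L) f≈0 =
    trans (+-cong (f≈0 0 (ℕ.s≤s ℕ.z≤n)) (sumN-zero L (λ t t<L → f≈0 (suc t) (ℕ.s≤s t<L))))
          (+-identityˡ 0#)

  sumN-+ : ∀ L (f g : ℕ → Carrier) → sumN L (λ t → f t + g t) ≈ sumN L f + sumN L g
  sumN-+ zero    f g = sym (+-identityˡ 0#)
  sumN-+ (suc L) f g = trans (+-congˡ (sumN-+ L (f ∘ suc) (g ∘ suc))) (interchange _ _ _ _)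
    where open import Algebra.Properties.CommutativeSemigroup +-commutativeSemigroup using (interchange)

  *-distribˡ-sumN : ∀ L a (f : ℕ → Carrier) → a * sumN L f ≈ sumN L (λ t → a * f t)
  *-distribˡ-sumN zero    a f = zeroʳ a
  *-distribˡ-sumN (suc L) a f = trans (distribˡ a _ _) (+-congˡ (*-distribˡ-sumN L a (f ∘ suc)))

  *-distribʳ-sumN : ∀ L a (f : ℕ → Carrier) → sumN L f * a ≈ sumN L (λ t → f t * a)
  *-distribʳ-sumN zero    a f = zeroˡ a
  *-distribʳ-sumN (suc L) a f = trans (distribʳ a _ _) (+-congˡ (*-distribʳ-sumN L a (f ∘ suc)))

  sumN-last : ∀ L (f : ℕ → Carrier) → sumN (suc L) f ≈ sumN L f + f L
  sumN-last zero    f = trans (+-identityʳ _) (sym (+-identityˡ _))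
  sumN-last (suc L) f = trans (+-congˡ (sumN-last L (f ∘ suc))) (sym (+-assoc _ _ _))

  sumN-reverse : ∀ L (f : ℕ → Carrier) → sumN L f ≈ sumN L (λ t → f (L ℕ.∸ suc t))
  sumN-reverse zero    f = refl
  sumN-reverse (suc L) f = begin
      f 0 + sumN L (f ∘ suc)
    ≈⟨ +-congˡ (sumN-reverse L (f ∘ suc)) ⟩
      f 0 + sumN L (λ t → f (suc (L ℕ.∸ suc t)))
    ≈⟨ +-comm _ _ ⟩
      sumN L (λ t → f (suc (L ℕ.∸ suc t))) + f 0
    ≈⟨ +-cong (sumN-cong L (λ t t<L → reflexive (≡.cong f (≡.sym (ℕP.+-∸-assoc 1 t<L)))))
              (reflexive (≡.cong f (≡.sym (ℕP.n∸n≡0 L)))) ⟩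
      sumN L (λ t → f (suc L ℕ.∸ suc t)) + f (suc L ℕ.∸ suc L)
    ≈⟨ sym (sumN-last L (λ t → f (suc L ℕ.∸ suc t))) ⟩
      sumN (suc L) (λ t → f (suc L ℕ.∸ suc t)) ∎

  sumN-triangle : ∀ N (X : ℕ → ℕ → Carrier) →
                  sumN (suc N) (λ i → sumN (suc i) (X i))
                ≈ sumN (suc N) (λ j → sumN (suc (N ℕ.∸ j)) (λ l → X (j ℕ.+ l) j))
  sumN-triangle zero    X = refl
  sumN-triangle (suc N) X = begin
      (X 0 0 + 0#) + sumN (suc N) (λ i → X (suc i) 0 + sumN (suc i) (X (suc i) ∘ suc))
    ≈⟨ +-cong (+-identityʳ _) (sumN-+ (suc N) (λ i → X (suc i) 0) (λ i → sumN (suc i) (X (suc i) ∘ suc))) ⟩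
      X 0 0 + (sumN (suc N) (λ i → X (suc i) 0) + sumN (suc N) (λ i → sumN (suc i) (X (suc i) ∘ suc)))
    ≈⟨ +-congˡ (+-congˡ (sumN-triangle N (λ i j → X (suc i) (suc j)))) ⟩
      X 0 0 + (sumN (suc N) (λ i → X (suc i) 0)
              + sumN (suc N) (λ j → sumN (suc (N ℕ.∸ j)) (λ l → X (suc (j ℕ.+ l)) (suc j))))
    ≈⟨ sym (+-assoc _ _ _) ⟩
      (X 0 0 + sumN (suc N) (λ i → X (suc i) 0))
      + sumN (suc N) (λ j → sumN (suc (N ℕ.∸ j)) (λ l → X (suc (j ℕ.+ l)) (suc j))) ∎

  Seq : Set
  Seq = ℕ → Carrier

  conv : Seq → Seq → Seq
  conv A B N = sumN (suc N) (λ i → A i * B (N ℕ.∸ i))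

  conv-cong : ∀ {A A' B B'} → (∀ i → A i ≈ A' i) → (∀ i → B i ≈ B' i) →
              ∀ N → conv A B N ≈ conv A' B' N
  conv-cong A≈A' B≈B' N = sumN-cong (suc N) (λ i _ → *-cong (A≈A' i) (B≈B' (N ℕ.∸ i)))

  conv-comm : ∀ A B N → conv A B N ≈ conv B A N
  conv-comm A B N = trans (sumN-reverse (suc N) (λ i → A i * B (N ℕ.∸ i)))
    (sumN-cong (suc N) {λ t → A (N ℕ.∸ t) * B (N ℕ.∸ (N ℕ.∸ t))} {λ t → B t * A (N ℕ.∸ t)}
      (λ t t≤N → trans (*-comm _ _)
      (*-congʳ (reflexive (≡.cong B (ℕP.m∸[m∸n]≡n (ℕP.≤-pred t≤N)))))))

  conv-distribˡ : ∀ A B C N → conv A (λ i → B i + C i) N ≈ conv A B N + conv A C N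
  conv-distribˡ A B C N =
    trans (sumN-cong (suc N) (λ i _ → distribˡ (A i) (B (N ℕ.∸ i)) (C (N ℕ.∸ i))))
          (sumN-+ (suc N) (λ i → A i * B (N ℕ.∸ i)) (λ i → A i * C (N ℕ.∸ i)))

  conv-assoc : ∀ A B C N → conv (conv A B) C N ≈ conv A (conv B C) N
  conv-assoc A B C N = begin
      sumN (suc N) (λ i → conv A B i * C (N ℕ.∸ i))
    ≈⟨ sumN-cong (suc N) (λ i _ → *-distribʳ-sumN (suc i) (C (N ℕ.∸ i)) (λ j → A j * B (i ℕ.∸ j))) ⟩
      sumN (suc N) (λ i → sumN (suc i) (λ j → (A j * B (i ℕ.∸ j)) * C (N ℕ.∸ i)))
    ≈⟨ sumN-triangle N (λ i j → (A j * B (i ℕ.∸ j)) * C (N ℕ.∸ i)) ⟩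
      sumN (suc N) (λ j → sumN (suc (N ℕ.∸ j)) (λ l → (A j * B (j ℕ.+ l ℕ.∸ j)) * C (N ℕ.∸ (j ℕ.+ l))))
    ≈⟨ sumN-cong (suc N) {g = λ j → A j * conv B C (N ℕ.∸ j)}
         (λ j _ → trans (sumN-cong (suc (N ℕ.∸ j)) (λ l _ → reassociate j l))
                        (sym (*-distribˡ-sumN (suc (N ℕ.∸ j)) (A j) (λ l → B l * C (N ℕ.∸ j ℕ.∸ l))))) ⟩
      sumN (suc N) (λ j → A j * conv B C (N ℕ.∸ j)) ∎
    where
    reassociate : ∀ j l → (A j * B (j ℕ.+ l ℕ.∸ j)) * C (N ℕ.∸ (j ℕ.+ l))
                        ≈ A j * (B l * C (N ℕ.∸ j ℕ.∸ l))
    reassociate j l = trans (*-assoc _ _ _)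
      (*-congˡ (*-cong (reflexive (≡.cong B (ℕP.m+n∸m≡n j l)))
                       (reflexive (≡.cong C (≡.sym (ℕP.∸-+-assoc N j l))))))

  delay : Seq → Seq
  delay A zero    = 0#
  delay A (suc i) = A i

  delay-cong : ∀ {A B} → (∀ i → A i ≈ B i) → ∀ i → delay A i ≈ delay B i
  delay-cong A≈B zero    = refl
  delay-cong A≈B (suc i) = A≈B i

  conv-delayˡ : ∀ A B N → conv (delay A) B N ≈ delay (conv A B) N
  conv-delayˡ A B zero    = trans (+-identityʳ _) (zeroˡ _)
  conv-delayˡ A B (suc N) = trans (+-congʳ (zeroˡ _)) (+-identityˡ _)

  conv-delayʳ : ∀ A B N → conv A (delay B) N ≈ delay (conv A B) N
  conv-delayʳ A B N = trans (conv-comm A (delay B) N)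
    (trans (conv-delayˡ B A N) (delay-cong (conv-comm B A) N))

  shift : ℕ → Seq → Seq
  shift zero    A = A
  shift (suc p) A = delay (shift p A)

  shift-cong : ∀ p {A B} → (∀ i → A i ≈ B i) → ∀ i → shift p A i ≈ shift p B i
  shift-cong zero    A≈B = A≈B
  shift-cong (suc p) A≈B = delay-cong (shift-cong p A≈B)

  conv-shift : ∀ p r A B N → conv (shift p A) (shift r B) N ≈ shift (p ℕ.+ r) (conv A B) N
  conv-shift zero    zero    A B N = refl
  conv-shift zero    (suc r) A B N =
    trans (conv-delayʳ A (shift r B) N) (delay-cong (conv-shift zero r A B) N)
  conv-shift (suc p) r       A B N =
    trans (conv-delayˡ (shift p A) (shift r B) N) (delay-cong (conv-shift p r A B) N)

  conv-constˡ : ∀ (U G : Seq) u → U 0 ≈ u → (∀ i → U (suc i) ≈ 0#) → ∀ N → conv U G N ≈ u * G N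
  conv-constˡ U G u U0≈u U+≈0 N =
    trans (+-cong (*-congʳ U0≈u) (sumN-zero N (λ t _ → trans (*-congʳ (U+≈0 t)) (zeroˡ _))))
          (+-identityʳ _)

module LaurentSeriesRing (F : FiniteField) where
  open FiniteField F hiding (zero)
  open LS F
  open Convolution F
  open import Algebra.Properties.Ring ring using (-0#≈0#)
  open import Relation.Binary.Reasoning.Setoid setoid

  down : ℕ → K → Seq
  down T f i = coeff f (+ T ℤ.- + i)

  private
    mulCoeff-below : ∀ f g n → n ℤ.≤ + (top f ℕ.+ top g) →
      mulCoeff f g n ≈ sumN (suc ℤ.∣ + (top f ℕ.+ top g) ℤ.- n ∣)
                          (λ t → coeff f ((n ℤ.- + top g) ℤ.+ + t) * coeff g (n ℤ.- ((n ℤ.- + top g) ℤ.+ + t)))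
    mulCoeff-below f g n n≤ with n ℤP.≤? + (top f ℕ.+ top g)
    ... | yes _  = refl
    ... | no  n≰ = ⊥-elim (n≰ n≤)

  -- mulCoeff f g n sums f_(n-tg+t) g_(tg-t) over t ≤ tf + tg - n; at n = tf + tg - N these are
  -- the terms of the N-th convolution coefficient, in reverse order.
  coeff-*K-top : ∀ f g N → down (top f ℕ.+ top g) (f *K g) N ≈ conv (down (top f) f) (down (top g) g) N
  coeff-*K-top f g N = begin
      mulCoeff f g n
    ≈⟨ mulCoeff-below f g n (ℤP.i-j≤i (+ Tfg) (+ N)) ⟩
      sumN (suc ℤ.∣ + Tfg ℤ.- n ∣) term
    ≡⟨ ≡.cong (λ L → sumN (suc L) term) (≡.cong ℤ.∣_∣ (a-[a-b]≡b (+ Tfg) (+ N))) ⟩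
      sumN (suc N) term
    ≈⟨ sumN-cong (suc N) (λ t t≤N → *-cong (reflexive (≡.cong (coeff f) (fIndex t (ℕP.≤-pred t≤N))))
                                           (reflexive (≡.cong (coeff g) (gIndex n (+ tg) (+ t))))) ⟩
      sumN (suc N) (λ t → down tf f (N ℕ.∸ t) * down tg g t)
    ≈⟨ sumN-cong (suc N) {g = λ t → down tg g t * down tf f (N ℕ.∸ t)} (λ t _ → *-comm _ _) ⟩
      conv (down tg g) (down tf f) N
    ≈⟨ conv-comm (down tg g) (down tf f) N ⟩
      conv (down tf f) (down tg g) N ∎
    where
    open import Data.Integer.Tactic.RingSolver using (solve-∀)
    tf = top f
    tg = top g
    Tfg = tf ℕ.+ tg
    n = + Tfg ℤ.- + N
    term = λ t → coeff f ((n ℤ.- + tg) ℤ.+ + t) * coeff g (n ℤ.- ((n ℤ.- + tg) ℤ.+ + t))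
    a-[a-b]≡b : ∀ (a b : ℤ) → a ℤ.- (a ℤ.- b) ≡ b
    a-[a-b]≡b = solve-∀
    gIndex : ∀ (x b d : ℤ) → x ℤ.- ((x ℤ.- b) ℤ.+ d) ≡ b ℤ.- d
    gIndex = solve-∀
    reindex : ∀ (a b c d : ℤ) → (((a ℤ.+ b) ℤ.- c) ℤ.- b) ℤ.+ d ≡ a ℤ.- (c ℤ.- d)
    reindex = solve-∀
    fIndex : ∀ t → t ℕ.≤ N → (n ℤ.- + tg) ℤ.+ + t ≡ + tf ℤ.- + (N ℕ.∸ t)
    fIndex t t≤N =
      ≡.trans (≡.cong (λ x → ((x ℤ.- + N) ℤ.- + tg) ℤ.+ + t) (ℤP.pos-+ tf tg))
     (≡.trans (reindex (+ tf) (+ tg) (+ N) (+ t))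
              (≡.cong (λ x → + tf ℤ.- x) (≡.trans (ℤP.m-n≡m⊖n N t) (ℤP.⊖-≥ t≤N))))

  down-suc : ∀ T f i → down (suc T) f (suc i) ≡ down T f i
  down-suc T f i = ≡.cong (coeff f)
    (≡.trans (≡.cong₂ ℤ._-_ (ℤP.pos-+ 1 T) (ℤP.pos-+ 1 i)) (cancel (+ T) (+ i)))
    where
    open import Data.Integer.Tactic.RingSolver using (solve-∀)
    cancel : ∀ (a b : ℤ) → (1ℤ ℤ.+ a) ℤ.- (1ℤ ℤ.+ b) ≡ a ℤ.- b
    cancel = solve-∀

  down-shift : ∀ p T f → top f ℕ.≤ T → ∀ i → down (p ℕ.+ T) f i ≈ shift p (down T f) i
  down-shift zero    T f top≤T i       = refl
  down-shift (suc p) T f top≤T zero    =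
    vanish f _ (≡.subst (+ top f ℤ.<_) (≡.sym (ℤP.+-identityʳ (+ suc (p ℕ.+ T))))
                        (ℤ.+<+ (ℕ.s≤s (ℕP.≤-trans top≤T (ℕP.m≤n+m T p)))))
  down-shift (suc p) T f top≤T (suc i) =
    trans (reflexive (down-suc (p ℕ.+ T) f i)) (down-shift p T f top≤T i)

  coeff-*K-down : ∀ f g T₁ T₂ → top f ℕ.≤ T₁ → top g ℕ.≤ T₂ → ∀ N →
                  down (T₁ ℕ.+ T₂) (f *K g) N ≈ conv (down T₁ f) (down T₂ g) N
  coeff-*K-down f g T₁ T₂ f≤T₁ g≤T₂ N =
    ≡.subst₂ (λ a b → down (a ℕ.+ b) (f *K g) N ≈ conv (down a f) (down b g) N)
             (ℕP.m∸n+n≡m f≤T₁) (ℕP.m∸n+n≡m g≤T₂) (padded (T₁ ℕ.∸ top f) (T₂ ℕ.∸ top g))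
    where
    open import Data.Nat.Tactic.RingSolver using (solve-∀)
    swap : ∀ (a b c d : ℕ) → (a ℕ.+ b) ℕ.+ (c ℕ.+ d) ≡ (a ℕ.+ c) ℕ.+ (b ℕ.+ d)
    swap = solve-∀
    padded : ∀ p r → down ((p ℕ.+ top f) ℕ.+ (r ℕ.+ top g)) (f *K g) N
                   ≈ conv (down (p ℕ.+ top f) f) (down (r ℕ.+ top g) g) N
    padded p r = begin
        down ((p ℕ.+ top f) ℕ.+ (r ℕ.+ top g)) (f *K g) N
      ≡⟨ ≡.cong (λ T → down T (f *K g) N) (swap p (top f) r (top g)) ⟩
        down ((p ℕ.+ r) ℕ.+ (top f ℕ.+ top g)) (f *K g) N
      ≈⟨ down-shift (p ℕ.+ r) (top f ℕ.+ top g) (f *K g) ℕP.≤-refl N ⟩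
        shift (p ℕ.+ r) (down (top f ℕ.+ top g) (f *K g)) N
      ≈⟨ shift-cong (p ℕ.+ r) (coeff-*K-top f g) N ⟩
        shift (p ℕ.+ r) (conv (down (top f) f) (down (top g) g)) N
      ≈⟨ sym (conv-shift p r (down (top f) f) (down (top g) g) N) ⟩
        conv (shift p (down (top f) f)) (shift r (down (top g) g)) N
      ≈⟨ conv-cong (λ i → sym (down-shift p (top f) f ℕP.≤-refl i))
                   (λ i → sym (down-shift r (top g) g ℕP.≤-refl i)) N ⟩
        conv (down (p ℕ.+ top f) f) (down (r ℕ.+ top g) g) N ∎

  ≈K-by-down : ∀ f g T → top f ℕ.≤ T → top g ℕ.≤ T → (∀ N → down T f N ≈ down T g N) → f ≈K g
  ≈K-by-down f g T f≤T g≤T f≈g d with d ℤP.≤? + T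
  ... | yes d≤T = ≡.subst (λ x → coeff f x ≈ coeff g x) T-[T-d]≡d (f≈g ℤ.∣ + T ℤ.- d ∣)
    where
    open import Data.Integer.Tactic.RingSolver using (solve-∀)
    cancel : ∀ (a b : ℤ) → a ℤ.- (a ℤ.- b) ≡ b
    cancel = solve-∀
    T-[T-d]≡d : + T ℤ.- + ℤ.∣ + T ℤ.- d ∣ ≡ d
    T-[T-d]≡d = ≡.trans (≡.cong (λ x → + T ℤ.- x) (ℤP.0≤i⇒+∣i∣≡i (ℤP.i≤j⇒0≤j-i d≤T)))
                        (cancel (+ T) d)
  ... | no  d≰T = trans (vanish f d (ℤP.≤-<-trans (ℤ.+≤+ f≤T) (ℤP.≰⇒> d≰T)))
                        (sym (vanish g d (ℤP.≤-<-trans (ℤ.+≤+ g≤T) (ℤP.≰⇒> d≰T))))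

  *K-cong : ∀ {f f' g g'} → f ≈K f' → g ≈K g' → (f *K g) ≈K (f' *K g')
  *K-cong {f} {f'} {g} {g'} f≈f' g≈g' =
    ≈K-by-down (f *K g) (f' *K g') (T₁ ℕ.+ T₂)
      (ℕP.+-mono-≤ f≤T₁ g≤T₂) (ℕP.+-mono-≤ f'≤T₁ g'≤T₂)
      (λ N → trans (coeff-*K-down f g T₁ T₂ f≤T₁ g≤T₂ N)
             (trans (conv-cong {down T₁ f} {down T₁ f'} {down T₂ g} {down T₂ g'}
                               (λ _ → f≈f' _) (λ _ → g≈g' _) N)
                    (sym (coeff-*K-down f' g' T₁ T₂ f'≤T₁ g'≤T₂ N))))
    where
    T₁ = top f ℕ.⊔ top f'
    T₂ = top g ℕ.⊔ top g'
    f≤T₁ = ℕP.m≤m⊔n (top f) (top f')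
    f'≤T₁ = ℕP.m≤n⊔m (top f) (top f')
    g≤T₂ = ℕP.m≤m⊔n (top g) (top g')
    g'≤T₂ = ℕP.m≤n⊔m (top g) (top g')

  *K-comm : ∀ f g → (f *K g) ≈K (g *K f)
  *K-comm f g =
    ≈K-by-down (f *K g) (g *K f) (top f ℕ.+ top g) ℕP.≤-refl (ℕP.≤-reflexive (ℕP.+-comm (top g) (top f)))
    (λ N → trans (coeff-*K-top f g N)
           (trans (conv-comm (down (top f) f) (down (top g) g) N)
                  (sym (≡.subst (λ T → down T (g *K f) N ≈ conv (down (top g) g) (down (top f) f) N)
                                (ℕP.+-comm (top g) (top f)) (coeff-*K-top g f N)))))

  *K-assoc : ∀ f g h → ((f *K g) *K h) ≈K (f *K (g *K h))
  *K-assoc f g h = ≈K-by-down ((f *K g) *K h) (f *K (g *K h)) ((tf ℕ.+ tg) ℕ.+ th) ℕP.≤-refl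
      (ℕP.≤-reflexive (≡.sym (ℕP.+-assoc tf tg th)))
      (λ N → begin
         down ((tf ℕ.+ tg) ℕ.+ th) ((f *K g) *K h) N
       ≈⟨ coeff-*K-top (f *K g) h N ⟩
         conv (down (tf ℕ.+ tg) (f *K g)) (down th h) N
       ≈⟨ conv-cong {B = down th h} (coeff-*K-top f g) (λ _ → refl) N ⟩
         conv (conv (down tf f) (down tg g)) (down th h) N
       ≈⟨ conv-assoc (down tf f) (down tg g) (down th h) N ⟩
         conv (down tf f) (conv (down tg g) (down th h)) N
       ≈⟨ conv-cong {A = down tf f} (λ _ → refl) (λ i → sym (coeff-*K-top g h i)) N ⟩
         conv (down tf f) (down (tg ℕ.+ th) (g *K h)) N
       ≈⟨ sym (coeff-*K-top f (g *K h) N) ⟩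
         down (tf ℕ.+ (tg ℕ.+ th)) (f *K (g *K h)) N
       ≡⟨ ≡.cong (λ T → down T (f *K (g *K h)) N) (≡.sym (ℕP.+-assoc tf tg th)) ⟩
         down ((tf ℕ.+ tg) ℕ.+ th) (f *K (g *K h)) N ∎)
    where
    tf = top f
    tg = top g
    th = top h

  *K-distribˡ : ∀ f g h → (f *K (g +K h)) ≈K ((f *K g) +K (f *K h))
  *K-distribˡ f g h = ≈K-by-down (f *K (g +K h)) ((f *K g) +K (f *K h)) (top f ℕ.+ T₂) ℕP.≤-refl
      (ℕP.⊔-lub (ℕP.+-monoʳ-≤ (top f) g≤T₂) (ℕP.+-monoʳ-≤ (top f) h≤T₂))
      (λ N → trans (coeff-*K-top f (g +K h) N)
             (trans (conv-distribˡ (down (top f) f) (down T₂ g) (down T₂ h) N)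
                    (+-cong (sym (coeff-*K-down f g (top f) T₂ ℕP.≤-refl g≤T₂ N))
                            (sym (coeff-*K-down f h (top f) T₂ ℕP.≤-refl h≤T₂ N)))))
    where
    T₂ = top g ℕ.⊔ top h
    g≤T₂ = ℕP.m≤m⊔n (top g) (top h)
    h≤T₂ = ℕP.m≤n⊔m (top g) (top h)

  scalarCoeff : Carrier → ℤ → Carrier
  scalarCoeff c (+ zero)  = c
  scalarCoeff c (+ suc _) = 0#
  scalarCoeff c -[1+ _ ]  = 0#

  scalar : Carrier → K
  scalar c = mkK 0 (scalarCoeff c) vanishes
    where
    vanishes : ∀ d → + 0 ℤ.< d → scalarCoeff c d ≈ 0#
    vanishes (+ zero)  (ℤ.+<+ ())
    vanishes (+ suc n) _ = refl

  down-scalar-*K : ∀ c f N → down (top f) (scalar c *K f) N ≈ c * down (top f) f N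
  down-scalar-*K c f N = trans (coeff-*K-down (scalar c) f 0 (top f) ℕ.z≤n ℕP.≤-refl N)
                               (conv-constˡ (down 0 (scalar c)) (down (top f) f) c refl (λ _ → refl) N)

  *K-identityˡ : ∀ f → (scalar 1# *K f) ≈K f
  *K-identityˡ f = ≈K-by-down (scalar 1# *K f) f (top f) ℕP.≤-refl ℕP.≤-refl
    (λ N → trans (down-scalar-*K 1# f N) (*-identityˡ _))

  -- Wrapping ≈K in a record makes both sides recoverable by unification.
  record _≋_ (f g : K) : Set where
    constructor ⟦_⟧
    field ≋⇒≈K : f ≈K g
  open _≋_ public

  scalar-0 : scalar 0# ≋ 0K
  scalar-0 = ⟦ zeros ⟧
    where
    zeros : scalar 0# ≈K 0K
    zeros (+ zero)  = refl
    zeros (+ suc _) = refl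
    zeros -[1+ _ ]  = refl

  scalar-cong : ∀ {a b} → a ≈ b → scalar a ≋ scalar b
  scalar-cong {a} {b} a≈b = ⟦ coeffs ⟧
    where
    coeffs : scalar a ≈K scalar b
    coeffs (+ zero)  = a≈b
    coeffs (+ suc _) = refl
    coeffs -[1+ _ ]  = refl

  coeff-*K-zero : ∀ f g n → (∀ x y → x ℤ.+ y ≡ n → coeff f x ≈ 0# ⊎ coeff g y ≈ 0#) →
                  coeff (f *K g) n ≈ 0#
  coeff-*K-zero f g n split with n ℤP.≤? + (top f ℕ.+ top g)
  ... | no  _   = refl
  ... | yes _   = sumN-zero (suc ℤ.∣ + (top f ℕ.+ top g) ℤ.- n ∣) (λ t _ → term t)
    where
    open import Data.Integer.Tactic.RingSolver using (solve-∀)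
    x+[n-x]≡n : ∀ (x n : ℤ) → x ℤ.+ (n ℤ.- x) ≡ n
    x+[n-x]≡n = solve-∀
    term : ∀ t → coeff f ((n ℤ.- + top g) ℤ.+ + t) * coeff g (n ℤ.- ((n ℤ.- + top g) ℤ.+ + t)) ≈ 0#
    term t with split _ _ (x+[n-x]≡n ((n ℤ.- + top g) ℤ.+ + t) n)
    ... | inj₁ f≈0 = trans (*-congʳ f≈0) (zeroˡ _)
    ... | inj₂ g≈0 = trans (*-congˡ g≈0) (zeroʳ _)

  -- Kept opaque so that unification does not unfold the ring operations into coefficient records.
  opaque
    _⊕_ : K → K → K
    _⊕_ = _+K_

    ⊖_ : K → K
    ⊖ f = mkK (top f) (λ d → - coeff f d) (λ d top<d → trans (-‿cong (vanish f d top<d)) -0#≈0#)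

    _⊗_ : K → K → K
    _⊗_ = _*K_

  opaque
    unfolding _⊕_ ⊖_ _⊗_

    +K≡⊕ : ∀ f g → f +K g ≡ f ⊕ g
    +K≡⊕ f g = ≡.refl

    *K≡⊗ : ∀ f g → f *K g ≡ f ⊗ g
    *K≡⊗ f g = ≡.refl

    K-isCommutativeRing : IsCommutativeRing _≋_ _⊕_ _⊗_ ⊖_ 0K (scalar 1#)
    K-isCommutativeRing = record
      { isRing = record
        { +-isAbelianGroup = record
          { isGroup = record
            { isMonoid = record
              { isSemigroup = record
                { isMagma = record
                  { isEquivalence = record
                    { refl  = ⟦ (λ _ → refl) ⟧
                    ; sym   = λ p → ⟦ (λ d → sym (≋⇒≈K p d)) ⟧
                    ; trans = λ p q → ⟦ (λ d → trans (≋⇒≈K p d) (≋⇒≈K q d)) ⟧ }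
                  ; ∙-cong = λ p q → ⟦ (λ d → +-cong (≋⇒≈K p d) (≋⇒≈K q d)) ⟧ }
                ; assoc = λ _ _ _ → ⟦ (λ _ → +-assoc _ _ _) ⟧ }
              ; identity = (λ _ → ⟦ (λ _ → +-identityˡ _) ⟧) , (λ _ → ⟦ (λ _ → +-identityʳ _) ⟧) }
            ; inverse = (λ _ → ⟦ (λ _ → -‿inverseˡ _) ⟧) , (λ _ → ⟦ (λ _ → -‿inverseʳ _) ⟧)
            ; ⁻¹-cong = λ p → ⟦ (λ d → -‿cong (≋⇒≈K p d)) ⟧ }
          ; comm = λ _ _ → ⟦ (λ _ → +-comm _ _) ⟧ }
        ; *-cong = λ p q → ⟦ *K-cong (≋⇒≈K p) (≋⇒≈K q) ⟧
        ; *-assoc = λ f g h → ⟦ *K-assoc f g h ⟧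
        ; *-identity = (λ f → ⟦ *K-identityˡ f ⟧)
                     , (λ f → ⟦ (λ d → trans (*K-comm f (scalar 1#) d) (*K-identityˡ f d)) ⟧)
        ; distrib = (λ f g h → ⟦ *K-distribˡ f g h ⟧)
                  , (λ f g h → ⟦ (λ d → trans (*K-comm (g +K h) f d)
                                   (trans (*K-distribˡ f g h d)
                                          (+-cong (*K-comm f g d) (*K-comm f h d)))) ⟧) }
      ; *-comm = λ f g → ⟦ *K-comm f g ⟧ }

    scalar-+ : ∀ a b → scalar (a + b) ≋ (scalar a ⊕ scalar b)
    scalar-+ a b = ⟦ split ⟧
      where
      split : scalar (a + b) ≈K (scalar a +K scalar b)
      split (+ zero)  = refl
      split (+ suc _) = sym (+-identityˡ 0#)
      split -[1+ _ ]  = sym (+-identityˡ 0#)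

    scalar-* : ∀ a b → scalar (a * b) ≋ (scalar a ⊗ scalar b)
    scalar-* a b = ⟦ ≈K-by-down (scalar (a * b)) (scalar a *K scalar b) 0 ℕ.z≤n ℕ.z≤n
      (λ N → sym (trans (down-scalar-*K a (scalar b) N) (coeffs N))) ⟧
      where
      coeffs : ∀ N → a * down 0 (scalar b) N ≈ down 0 (scalar (a * b)) N
      coeffs zero    = refl
      coeffs (suc N) = zeroʳ a

    AbsLe-⊗ : ∀ {f g a b} → AbsLe f a → AbsLe g b → AbsLe (f ⊗ g) (a ℤ.+ b)
    AbsLe-⊗ {f} {g} {a} {b} f≤a g≤b d a+b<d = coeff-*K-zero f g d split
      where
      split : ∀ x y → x ℤ.+ y ≡ d → coeff f x ≈ 0# ⊎ coeff g y ≈ 0#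
      split x y x+y≡d with x ℤP.≤? a | y ℤP.≤? b
      ... | no  x≰a | _       = inj₁ (f≤a x (ℤP.≰⇒> x≰a))
      ... | yes _   | no  y≰b = inj₂ (g≤b y (ℤP.≰⇒> y≰b))
      ... | yes x≤a | yes y≤b =
        ⊥-elim (ℤP.<⇒≱ a+b<d (≡.subst (ℤ._≤ a ℤ.+ b) x+y≡d (ℤP.+-mono-≤ x≤a y≤b)))

    IsPoly-⊗ : ∀ {f g} → IsPoly f → IsPoly g → IsPoly (f ⊗ g)
    IsPoly-⊗ {f} {g} f-poly g-poly d d<0 = coeff-*K-zero f g d split
      where
      split : ∀ x y → x ℤ.+ y ≡ d → coeff f x ≈ 0# ⊎ coeff g y ≈ 0#
      split x y x+y≡d with x ℤP.<? 0ℤ | y ℤP.<? 0ℤ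
      ... | yes x<0 | _       = inj₁ (f-poly x x<0)
      ... | no  _   | yes y<0 = inj₂ (g-poly y y<0)
      ... | no  x≮0 | no  y≮0 =
        ⊥-elim (ℤP.<⇒≱ d<0 (≡.subst (0ℤ ℤ.≤_) x+y≡d
                                     (ℤP.+-mono-≤ (ℤP.≮⇒≥ x≮0) (ℤP.≮⇒≥ y≮0))))

    AbsLe-⊕ : ∀ {f g a} → AbsLe f a → AbsLe g a → AbsLe (f ⊕ g) a
    AbsLe-⊕ f≤a g≤a d a<d = trans (+-cong (f≤a d a<d) (g≤a d a<d)) (+-identityˡ 0#)

    IsPoly-⊕ : ∀ {f g} → IsPoly f → IsPoly g → IsPoly (f ⊕ g)
    IsPoly-⊕ f-poly g-poly d d<0 = trans (+-cong (f-poly d d<0) (g-poly d d<0)) (+-identityˡ 0#)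

    IsPoly-⊖ : ∀ {f} → IsPoly f → IsPoly (⊖ f)
    IsPoly-⊖ f-poly d d<0 = trans (-‿cong (f-poly d d<0)) -0#≈0#

  Kring : CommutativeRing 0ℓ 0ℓ
  Kring = record
    { Carrier = K ; _≈_ = _≋_ ; _+_ = _⊕_ ; _*_ = _⊗_ ; -_ = ⊖_ ; 0# = 0K ; 1# = scalar 1#
    ; isCommutativeRing = K-isCommutativeRing }

  IsPoly-scalar : ∀ c → IsPoly (scalar c)
  IsPoly-scalar c -[1+ _ ] _ = refl
  IsPoly-scalar c (+ _) (ℤ.+<+ ())

  AbsLe-resp : ∀ {f g a} → f ≋ g → AbsLe f a → AbsLe g a
  AbsLe-resp f≋g f≤a d a<d = trans (sym (≋⇒≈K f≋g d)) (f≤a d a<d)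

  AbsLe-mono : ∀ {f a b} → a ℤ.≤ b → AbsLe f a → AbsLe f b
  AbsLe-mono a≤b f≤a d b<d = f≤a d (ℤP.≤-<-trans a≤b b<d)

  ≋-scalar-const : ∀ {f} → IsPoly f → AbsLe f 0ℤ → f ≋ scalar (const f)
  ≋-scalar-const {f} f-poly f≤1 = ⟦ coeffs ⟧
    where
    coeffs : f ≈K scalar (const f)
    coeffs (+ zero)  = refl
    coeffs (+ suc n) = f≤1 (+ suc n) (ℤ.+<+ (ℕ.s≤s ℕ.z≤n))
    coeffs -[1+ n ]  = f-poly -[1+ n ] ℤ.-<+

  IsPoly-0 : IsPoly 0K
  IsPoly-0 _ _ = refl

  AbsLe-0 : ∀ a → AbsLe 0K a
  AbsLe-0 _ _ _ = refl

module SemiringSums {c ℓ} (R : Semiring c ℓ) where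
  open Semiring R
  open import Algebra.Properties.Semiring.Sum R
  open import Relation.Binary.Reasoning.Setoid setoid

  sum-zero : ∀ {n} (f : Fin n → Carrier) → (∀ i → f i ≈ 0#) → sum f ≈ 0#
  sum-zero {n} f f≈0 = trans (sum-cong-≋ f≈0) (sum-replicate-zero n)

  sum-single : ∀ {n} (f : Fin (suc n) → Carrier) i → (∀ j → j ≢ i → f j ≈ 0#) → sum f ≈ f i
  sum-single f i f≈0 = trans (sum-remove {i = i} f)
    (trans (+-congˡ (sum-zero _ (λ j → f≈0 _ (FinP.punchInᵢ≢i i j)))) (+-identityʳ _))

  sum-*-sum : ∀ {p q} (x : Fin p → Carrier) (Y : Fin p → Fin q → Carrier) (z : Fin q → Carrier) →
              sum (λ t → x t * sum (λ j → Y t j * z j)) ≈ sum (λ j → sum (λ t → x t * Y t j) * z j)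
  sum-*-sum x Y z = begin
      sum (λ t → x t * sum (λ j → Y t j * z j))
    ≈⟨ sum-cong-≋ (λ t → *-distribˡ-sum (x t) (λ j → Y t j * z j)) ⟩
      sum (λ t → sum (λ j → x t * (Y t j * z j)))
    ≈⟨ sum-cong-≋ (λ t → sum-cong-≋ (λ j → sym (*-assoc (x t) (Y t j) (z j)))) ⟩
      sum (λ t → sum (λ j → (x t * Y t j) * z j))
    ≈⟨ ∑-comm (λ t j → (x t * Y t j) * z j) ⟩
      sum (λ j → sum (λ t → (x t * Y t j) * z j))
    ≈⟨ sum-cong-≋ (λ j → sym (*-distribʳ-sum (z j) (λ t → x t * Y t j))) ⟩
      sum (λ j → sum (λ t → x t * Y t j) * z j) ∎

module LinearAlgebraOverK (F : FiniteField) where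
  open FiniteField F using () renaming (Carrier to 𝔽)
  open LS F
  open LaurentSeriesRing F
  open CommutativeRing Kring hiding (zero)
  open import Algebra.Properties.Semiring.Sum semiring
  open SemiringSums semiring
  open import Algebra.Properties.Group +-group using (inverseˡ-unique; x∙y⁻¹≈ε⇒x≈y)
  open import Relation.Binary.Reasoning.Setoid setoid

  sumK≡sum : ∀ {k} (f : Fin k → K) → sumK f ≡ sum f
  sumK≡sum {zero}  f = ≡.refl
  sumK≡sum {suc k} f = ≡.trans (≡.cong (f Fin.zero +K_) (sumK≡sum (f ∘ Fin.suc))) (+K≡⊕ _ _)

  scalar-sumF : ∀ {k} (g : Fin k → 𝔽) → scalar (sumF g) ≈ sum (scalar ∘ g)
  scalar-sumF {zero}  g = scalar-0
  scalar-sumF {suc k} g = trans (scalar-+ (g Fin.zero) (sumF (g ∘ Fin.suc))) (+-congˡ (scalar-sumF (g ∘ Fin.suc)))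

  IsPoly-sum : ∀ {k} {f : Fin k → K} → (∀ i → IsPoly (f i)) → IsPoly (sum f)
  IsPoly-sum {zero}  f-poly = IsPoly-0
  IsPoly-sum {suc k} f-poly = IsPoly-⊕ (f-poly Fin.zero) (IsPoly-sum (f-poly ∘ Fin.suc))

  AbsLe-sum : ∀ {k} {f : Fin k → K} {a} → (∀ i → AbsLe (f i) a) → AbsLe (sum f) a
  AbsLe-sum {zero} {a = a} _ = AbsLe-0 a
  AbsLe-sum {suc k} f≤a = AbsLe-⊕ (f≤a Fin.zero) (AbsLe-sum (f≤a ∘ Fin.suc))

  δK : ∀ {k} → Fin k → Fin k → K
  δK i j = scalar (δ i j)

  δK-diag : ∀ {k} (i : Fin k) → δK i i ≈ 1#
  δK-diag i with i Fin.≟ i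
  ... | yes _   = refl
  ... | no  i≢i = ⊥-elim (i≢i ≡.refl)

  δK-offdiag : ∀ {k} {i j : Fin k} → i ≢ j → δK i j ≈ 0#
  δK-offdiag {i = i} {j} i≢j with i Fin.≟ j
  ... | yes i≡j = ⊥-elim (i≢j i≡j)
  ... | no  _   = scalar-0

  sum-δˡ : ∀ {k} (c : Fin k → K) i → sum (λ j → δK i j * c j) ≈ c i
  sum-δˡ {suc k} c i =
    trans (sum-single (λ j → δK i j * c j) i
                      (λ j j≢i → trans (*-congʳ (δK-offdiag (j≢i ∘ ≡.sym))) (zeroˡ (c j))))
          (trans (*-congʳ (δK-diag i)) (*-identityˡ (c i)))

  sum-δʳ : ∀ {k} (c : Fin k → K) i → sum (λ j → δK j i * c j) ≈ c i
  sum-δʳ {suc k} c i =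
    trans (sum-single (λ j → δK j i * c j) i
                      (λ j j≢i → trans (*-congʳ (δK-offdiag j≢i)) (zeroˡ (c j))))
          (trans (*-congʳ (δK-diag i)) (*-identityˡ (c i)))

  δK-reindex : ∀ {k r} (ι : Fin r → Fin k) → (∀ {t t'} → ι t ≡ ι t' → t ≡ t') →
               ∀ t t' → δK (ι t) (ι t') ≡ δK t t'
  δK-reindex ι ι-inj t t' with ι t Fin.≟ ι t' | t Fin.≟ t'
  ... | yes _   | yes _   = ≡.refl
  ... | no  _   | no  _   = ≡.refl
  ... | yes ιt≡ | no  t≢  = ⊥-elim (t≢ (ι-inj ιt≡))
  ... | no  ιt≢ | yes t≡  = ⊥-elim (ιt≢ (≡.cong ι t≡))

  lin≋sum : ∀ {n k} (c : Fin k → K) (x : Fin k → Vec n) coord → lin c x coord ≈ sum (λ i → c i * x i coord)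
  lin≋sum c x coord = trans (reflexive (sumK≡sum _)) (sum-cong-≋ (λ i → reflexive (*K≡⊗ (c i) (x i coord))))

  lin-cong : ∀ {n k} {c d : Fin k → K} {x y : Fin k → Vec n} →
             (∀ i coord → c i * x i coord ≈ d i * y i coord) → ∀ coord → lin c x coord ≈ lin d y coord
  lin-cong {c = c} {d} {x} {y} terms coord =
    trans (lin≋sum c x coord) (trans (sum-cong-≋ (λ i → terms i coord)) (sym (lin≋sum d y coord)))

  lin-+ : ∀ {n k} (c d : Fin k → K) (x : Fin k → Vec n) coord →
          lin (λ i → c i + d i) x coord ≈ lin c x coord + lin d x coord
  lin-+ c d x coord = begin
      lin (λ i → c i + d i) x coord
    ≈⟨ lin≋sum _ x coord ⟩
      sum (λ i → (c i + d i) * x i coord)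
    ≈⟨ sum-cong-≋ (λ i → distribʳ (x i coord) (c i) (d i)) ⟩
      sum (λ i → c i * x i coord + d i * x i coord)
    ≈⟨ ∑-distrib-+ (λ i → c i * x i coord) (λ i → d i * x i coord) ⟩
      sum (λ i → c i * x i coord) + sum (λ i → d i * x i coord)
    ≈⟨ sym (+-cong (lin≋sum c x coord) (lin≋sum d x coord)) ⟩
      lin c x coord + lin d x coord ∎

  lin-neg : ∀ {n k} (c : Fin k → K) (x : Fin k → Vec n) coord → lin (λ i → - c i) x coord ≈ - lin c x coord
  lin-neg c x coord = inverseˡ-unique _ _ (begin
      lin (λ i → - c i) x coord + lin c x coord
    ≈⟨ sym (lin-+ (λ i → - c i) c x coord) ⟩
      lin (λ i → - c i + c i) x coord
    ≈⟨ lin≋sum _ x coord ⟩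
      sum (λ i → (- c i + c i) * x i coord)
    ≈⟨ sum-zero _ (λ i → trans (*-congʳ (-‿inverseˡ (c i))) (zeroˡ _)) ⟩
      0# ∎)

  lin-lin : ∀ {n k l} (c : Fin k → K) (b : Fin k → Fin l → K) (y : Fin l → Vec n) coord →
            lin c (λ t → lin (b t) y) coord ≈ lin (λ i → sum (λ t → c t * b t i)) y coord
  lin-lin c b y coord = begin
      lin c (λ t → lin (b t) y) coord
    ≈⟨ lin-cong (λ t coord' → *-congˡ (lin≋sum (b t) y coord')) coord ⟩
      lin c (λ t coord' → sum (λ i → b t i * y i coord')) coord
    ≈⟨ lin≋sum c (λ t coord' → sum (λ i → b t i * y i coord')) coord ⟩
      sum (λ t → c t * sum (λ i → b t i * y i coord))
    ≈⟨ sum-*-sum c b (λ i → y i coord) ⟩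
      sum (λ i → sum (λ t → c t * b t i) * y i coord)
    ≈⟨ sym (lin≋sum _ y coord) ⟩
      lin (λ i → sum (λ t → c t * b t i)) y coord ∎

  lin-δˡ : ∀ {n k} (x : Fin k → Vec n) j coord → lin (δK j) x coord ≈ x j coord
  lin-δˡ x j coord = trans (lin≋sum (δK j) x coord) (sum-δˡ (λ i → x i coord) j)

  lin-δʳ : ∀ {n k} (x : Fin k → Vec n) j coord → lin (λ i → δK i j) x coord ≈ x j coord
  lin-δʳ x j coord = trans (lin≋sum (λ i → δK i j) x coord) (sum-δʳ (λ i → x i coord) j)

  coeffs-unique : ∀ {n k} {v : Fin k → Vec n} → LinIndepR v → ∀ {c d} →
                  (∀ i → IsPoly (c i)) → (∀ i → IsPoly (d i)) →
                  (∀ coord → lin c v coord ≈ lin d v coord) → ∀ i → c i ≈ d i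
  coeffs-unique {v = v} v-indep {c} {d} c-poly d-poly c≈d i =
    x∙y⁻¹≈ε⇒x≈y (c i) (d i)
      ⟦ v-indep (λ i → c i - d i) (λ i → IsPoly-⊕ (c-poly i) (IsPoly-⊖ {d i} (d-poly i)))
                (λ coord → ≋⇒≈K (difference coord)) i ⟧
    where
    difference : ∀ coord → lin (λ i → c i - d i) v coord ≈ 0#
    difference coord = begin
        lin (λ i → c i - d i) v coord
      ≈⟨ lin-+ c (λ i → - d i) v coord ⟩
        lin c v coord + lin (λ i → - d i) v coord
      ≈⟨ +-cong (c≈d coord) (lin-neg d v coord) ⟩
        lin d v coord - lin d v coord
      ≈⟨ -‿inverseʳ _ ⟩
        0# ∎

  InLat-eq : ∀ {n k} {y : Fin k → Vec n} (p : Vec n) (p∈ : InLat y p) →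
             ∀ coord → p coord ≈ lin (proj₁ p∈) y coord
  InLat-eq p (_ , _ , p≈) coord = ⟦ p≈ coord ⟧

  InLat-resp : ∀ {n k} {y : Fin k → Vec n} {p q : Vec n} → (∀ coord → p coord ≈ q coord) →
               InLat y q → InLat y p
  InLat-resp {q = q} p≈q q∈@(c , c-poly , _) =
    c , c-poly , λ coord → ≋⇒≈K (trans (p≈q coord) (InLat-eq q q∈ coord))

  InLat-basis : ∀ {n k} (y : Fin k → Vec n) t → InLat y (y t)
  InLat-basis y t = δK t , (λ _ → IsPoly-scalar _) , λ coord → ≋⇒≈K (sym (lin-δˡ y t coord))

  InLat-+ : ∀ {n k} {y : Fin k → Vec n} {p q : Vec n} → InLat y p → InLat y q →
            InLat y (λ coord → p coord + q coord)
  InLat-+ {y = y} {p} {q} p∈@(c , c-poly , _) q∈@(d , d-poly , _) =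
    (λ i → c i + d i) , (λ i → IsPoly-⊕ (c-poly i) (d-poly i)) ,
    λ coord → ≋⇒≈K (trans (+-cong (InLat-eq p p∈ coord) (InLat-eq q q∈ coord)) (sym (lin-+ c d y coord)))

  InLat-lin : ∀ {n k l} {y : Fin l → Vec n} {c : Fin k → K} {x : Fin k → Vec n} →
              (∀ t → IsPoly (c t)) → (∀ t → c t ≈ 0# ⊎ InLat y (x t)) → InLat y (lin c x)
  InLat-lin {y = y} {c} {x} c-poly term∈ =
    (λ i → sum (λ t → c t * b t i)) ,
    (λ i → IsPoly-sum (λ t → IsPoly-⊗ (c-poly t) (b-poly t i))) ,
    λ coord → ≋⇒≈K (trans (lin-cong x≈b coord) (lin-lin c b y coord))
    where
    expand : ∀ t → Σ (Fin _ → K) λ b →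
               (∀ i → IsPoly (b i)) × (∀ coord → c t * x t coord ≈ c t * lin b y coord)
    expand t with term∈ t
    ... | inj₁ c≈0 = (λ _ → 0#) , (λ _ → IsPoly-0) ,
                     λ coord → trans (*-congʳ c≈0) (trans (zeroˡ _) (sym (trans (*-congʳ c≈0) (zeroˡ _))))
    ... | inj₂ x∈@(b , b-poly , _) = b , b-poly , λ coord → *-congˡ (InLat-eq (x t) x∈ coord)
    b : Fin _ → Fin _ → K
    b t = proj₁ (expand t)
    b-poly : ∀ t i → IsPoly (b t i)
    b-poly t = proj₁ (proj₂ (expand t))
    x≈b : ∀ t coord → c t * x t coord ≈ c t * lin (b t) y coord
    x≈b t = proj₂ (proj₂ (expand t))

  InLat-trans : ∀ {n k l} {y : Fin l → Vec n} {x : Fin k → Vec n} {p : Vec n} →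
                (∀ t → InLat y (x t)) → InLat x p → InLat y p
  InLat-trans {p = p} x∈y p∈@(c , c-poly , _) = InLat-resp (InLat-eq p p∈) (InLat-lin c-poly (inj₂ ∘ x∈y))

  LinIndepK⇒LinIndepR : ∀ {n k} {x : Fin k → Vec n} → LinIndepK x → LinIndepR x
  LinIndepK⇒LinIndepR x-indep c _ = x-indep c

  LinIndepK-reindex : ∀ {n k r} {x : Fin k → Vec n} (ι : Fin r → Fin k) →
                      (∀ {t t'} → ι t ≡ ι t' → t ≡ t') → LinIndepK x → LinIndepK (x ∘ ι)
  LinIndepK-reindex {x = x} ι ι-inj x-indep c Σcxι≈0 t = ≋⇒≈K (begin
      c t
    ≈⟨ sym (sum-δʳ c t) ⟩
      sum (λ t' → δK t' t * c t')
    ≈⟨ sum-cong-≋ (λ t' → trans (*-comm _ _) (*-congˡ (reflexive (≡.sym (δK-reindex ι ι-inj t' t))))) ⟩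
      c' (ι t)
    ≈⟨ ⟦ x-indep c' Σc'x≈0 (ι t) ⟧ ⟩
      0# ∎)
    where
    c' : Fin _ → K
    c' i = sum (λ t' → c t' * δK (ι t') i)
    Σc'x≈0 : VZero (lin c' x)
    Σc'x≈0 coord = ≋⇒≈K (begin
        lin c' x coord
      ≈⟨ sym (lin-lin c (δK ∘ ι) x coord) ⟩
        lin c (λ t' → lin (δK (ι t')) x) coord
      ≈⟨ lin-cong (λ t' coord' → *-congˡ (lin-δˡ x (ι t') coord')) coord ⟩
        lin c (x ∘ ι) coord
      ≈⟨ ⟦ Σcxι≈0 coord ⟧ ⟩
        0# ∎)

  IsRBasis⇒LinIndepK : ∀ {n k k'} {w : Fin k → Vec n} {v : Fin k' → Vec n} →
                       LinIndepK w → IsRBasis w v → LinIndepK v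
  IsRBasis⇒LinIndepK {w = w} {v} w-indep (v∈Λ , Λ⊆⟨v⟩ , v-indep) c Σcv≈0 i = ≋⇒≈K (begin
      c i
    ≈⟨ sym (sum-δʳ c i) ⟩
      sum (λ i' → δK i' i * c i')
    ≈⟨ sum-cong-≋ (λ i' → trans (*-comm _ _) (*-congˡ (sym (EG≈δ i' i)))) ⟩
      sum (λ i' → c i' * sum (λ q → E i' q * G q i))
    ≈⟨ sum-*-sum c E (λ q → G q i) ⟩
      sum (λ q → sum (λ i' → c i' * E i' q) * G q i)
    ≈⟨ sum-zero _ (λ q → trans (*-congʳ ⟦ w-indep _ cE-zero q ⟧) (zeroˡ _)) ⟩
      0# ∎)
    where
    E : Fin _ → Fin _ → K
    E i = proj₁ (v∈Λ i)
    G : Fin _ → Fin _ → K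
    G q = proj₁ (Λ⊆⟨v⟩ (w q) (InLat-basis w q))
    E-poly : ∀ i q → IsPoly (E i q)
    E-poly i = proj₁ (proj₂ (v∈Λ i))
    G-poly : ∀ q i → IsPoly (G q i)
    G-poly q = proj₁ (proj₂ (Λ⊆⟨v⟩ (w q) (InLat-basis w q)))
    v≈Ew : ∀ i coord → v i coord ≈ lin (E i) w coord
    v≈Ew i coord = ⟦ proj₂ (proj₂ (v∈Λ i)) coord ⟧
    w≈Gv : ∀ q coord → w q coord ≈ lin (G q) v coord
    w≈Gv q coord = ⟦ proj₂ (proj₂ (Λ⊆⟨v⟩ (w q) (InLat-basis w q))) coord ⟧
    EG≈δ : ∀ i' i → sum (λ q → E i' q * G q i) ≈ δK i' i
    EG≈δ i' = coeffs-unique v-indep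
      (λ i → IsPoly-sum (λ q → IsPoly-⊗ (E-poly i' q) (G-poly q i)))
      (λ _ → IsPoly-scalar _)
      (λ coord → begin
          lin (λ i → sum (λ q → E i' q * G q i)) v coord
        ≈⟨ sym (lin-lin (E i') G v coord) ⟩
          lin (E i') (λ q → lin (G q) v) coord
        ≈⟨ lin-cong (λ q coord' → *-congˡ (sym (w≈Gv q coord'))) coord ⟩
          lin (E i') w coord
        ≈⟨ sym (v≈Ew i' coord) ⟩
          v i' coord
        ≈⟨ sym (lin-δˡ v i' coord) ⟩
          lin (δK i') v coord ∎)
    cE-zero : VZero (lin (λ q → sum (λ i' → c i' * E i' q)) w)
    cE-zero coord = ≋⇒≈K (begin
        lin (λ q → sum (λ i' → c i' * E i' q)) w coord
      ≈⟨ sym (lin-lin c E w coord) ⟩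
        lin c (λ i' → lin (E i') w) coord
      ≈⟨ lin-cong (λ i' coord' → *-congˡ (sym (v≈Ew i' coord'))) coord ⟩
        lin c v coord
      ≈⟨ ⟦ Σcv≈0 coord ⟧ ⟩
        0# ∎)

  NormLe-mono : ∀ {n} {x : Vec n} {a b} → a ℤ.≤ b → NormLe x a → NormLe x b
  NormLe-mono {x = x} a≤b x≤a coord = AbsLe-mono {x coord} a≤b (x≤a coord)

  NormLe-lin : ∀ {n k} {c : Fin k → K} {x : Fin k → Vec n} {E} →
               (∀ i coord → AbsLe (c i * x i coord) E) → NormLe (lin c x) E
  NormLe-lin {c = c} {x} terms≤E coord = AbsLe-resp (sym (lin≋sum c x coord)) (AbsLe-sum (λ i → terms≤E i coord))

  -- With r the first index such that λ_j ≤ λ_r, the vectors u_j and u_i (i < r) are r + 1 independent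
  -- lattice vectors of norm below q^λ_r, contradicting that the (r+1)-st minimum is q^λ_r.
  succMin-lowerBound : ∀ {n k} {w : Fin k → Vec n} {lam : Fin k → ℤ} → (∀ i → IsSuccMin w i (lam i)) →
                       ∀ {u : Fin k → Vec n} → LinIndepK u → (∀ j → InLat w (u j)) →
                       (∀ j → NormLe (u j) (lam j)) → ∀ j → ¬ NormLe (u j) (lam j ℤ.- 1ℤ)
  succMin-lowerBound {k = k} {w} {lam} λ-min {u} u-indep u∈Λ u≤λ j uj-short
    with FinP.¬∀⟶∃¬-smallest k (λ t → lam t ℤ.< lam j) (λ t → lam t ℤP.<? lam j)
                              (λ all< → ℤP.<-irrefl ≡.refl (all< j))
  ... | r , λr≮λj , below = proj₂ (λ-min r) (u ∘ ι , u∈Λ ∘ ι , LinIndepK-reindex ι ι-inj u-indep , short)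
    where
    ι : Fin (suc (toℕ r)) → Fin k
    ι Fin.zero    = j
    ι (Fin.suc y) = Fin.inject y
    ι-inj : ∀ {t t'} → ι t ≡ ι t' → t ≡ t'
    ι-inj {Fin.zero}  {Fin.zero}   _  = ≡.refl
    ι-inj {Fin.zero}  {Fin.suc y'} eq = ⊥-elim (ℤP.<-irrefl (≡.cong lam (≡.sym eq)) (below y'))
    ι-inj {Fin.suc y} {Fin.zero}   eq = ⊥-elim (ℤP.<-irrefl (≡.cong lam eq) (below y))
    ι-inj {Fin.suc y} {Fin.suc y'} eq =
      ≡.cong Fin.suc (FinP.toℕ-injective (≡.trans (≡.sym (FinP.toℕ-inject y))
                                                  (≡.trans (≡.cong toℕ eq) (FinP.toℕ-inject y'))))
    λj-1≤λr-1 : lam j ℤ.- 1ℤ ℤ.≤ lam r ℤ.- 1ℤ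
    λj-1≤λr-1 = ℤP.+-monoˡ-≤ (ℤ.- 1ℤ) (ℤP.≮⇒≥ λr≮λj)
    short : ∀ t → NormLe (u (ι t)) (lam r ℤ.- 1ℤ)
    short Fin.zero    = NormLe-mono {x = u j} λj-1≤λr-1 uj-short
    short (Fin.suc y) =
      NormLe-mono {x = u (Fin.inject y)} (ℤP.≤-trans (<⇒≤-1 (below y)) λj-1≤λr-1) (u≤λ (Fin.inject y))
      where
      <⇒≤-1 : ∀ {x z} → x ℤ.< z → x ℤ.≤ z ℤ.- 1ℤ
      <⇒≤-1 {x} {z} x<z = ≡.subst (x ℤ.≤_) (ℤP.+-comm ℤ.-1ℤ z) (ℤP.i<j⇒i≤pred[j] x<z)

module BlockTriangular (F : FiniteField) {k m : ℕ} (blk : Fin k → Fin m) (a : Fin k → Fin k → LS.K F)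
  (a-poly : ∀ i j → LS.IsPoly F (a i j))
  (a-below-zero : ∀ i j → blk j Fin.< blk i → LS._≈K_ F (a i j) (LS.0K F))
  (a-diag-const : ∀ i j → blk i ≡ blk j → LS.AbsLe F (a i j) 0ℤ)
  (a-diag-inv : ∀ ℓ → LS.InvertibleOn F (λ j → does (blk j Fin.≟ ℓ)) (λ i j → LS.const F (a i j)))
  where
  open FiniteField F using () renaming (Carrier to 𝔽; _*_ to _*F_; 0# to 0F)
  open LS F
  open LaurentSeriesRing F
  open LinearAlgebraOverK F
  open CommutativeRing Kring hiding (zero)
  open import Algebra.Properties.Semiring.Sum semiring
  open SemiringSums semiring
  open import Algebra.Properties.Ring ring using (-0#≈0#)
  open import Algebra.Properties.Group +-group using (\\-leftDividesˡ)
  open import Relation.Binary.Reasoning.Setoid setoid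
  open import Induction.WellFounded using (module All)
  import Relation.Binary.Construct.On as On
  import Data.Fin.Induction as FinI

  InBlock : Fin m → Fin k → Bool
  InBlock ℓ j = does (blk j Fin.≟ ℓ)

  InBlock⇒≡ : ∀ {ℓ j} → T (InBlock ℓ j) → blk j ≡ ℓ
  InBlock⇒≡ {ℓ} {j} j∈ℓ with blk j Fin.≟ ℓ
  ... | yes eq = eq
  ... | no  _  = ⊥-elim j∈ℓ

  ≡⇒InBlock : ∀ {ℓ j} → blk j ≡ ℓ → T (InBlock ℓ j)
  ≡⇒InBlock {ℓ} {j} eq with blk j Fin.≟ ℓ
  ... | yes _  = tt
  ... | no neq = ⊥-elim (neq eq)

  <-blocks⇒≢ : ∀ {i j} → blk i Fin.< blk j → j ≢ i
  <-blocks⇒≢ i<j j≡i = FinP.<-irrefl (≡.cong blk (≡.sym j≡i)) i<j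

  ascending-blocks : (P : Fin k → Set) → (∀ i → (∀ {i'} → blk i' Fin.< blk i → P i') → P i) →
                     ∀ i → P i
  ascending-blocks = All.wfRec (On.wellFounded blk FinI.<-wellFounded) 0ℓ

  descending-blocks : (P : Fin k → Set) → (∀ j → (∀ {j'} → blk j Fin.< blk j' → P j') → P j) →
                      ∀ j → P j
  descending-blocks = All.wfRec (On.wellFounded blk FinI.>-wellFounded) 0ℓ

  A : Fin k → Fin k → 𝔽
  A i j = const (a i j)

  B : Fin m → Fin k → Fin k → 𝔽
  B ℓ = proj₁ (a-diag-inv ℓ)

  a≈A : ∀ {i j} → blk i ≡ blk j → a i j ≈ scalar (A i j)
  a≈A {i} {j} i~j = ≋-scalar-const (a-poly i j) (a-diag-const i j i~j)

  mask : Bool → K → K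
  mask b x = if b then x else 0#

  mask-*ˡ : ∀ b x y → mask b x * y ≈ mask b (x * y)
  mask-*ˡ true  x y = refl
  mask-*ˡ false x y = zeroˡ y

  mask-*ʳ : ∀ b x y → y * mask b x ≈ mask b (y * x)
  mask-*ʳ true  x y = refl
  mask-*ʳ false x y = zeroʳ y

  mask-*-zero : ∀ b {x y} → (T b → y ≈ 0#) → mask b x * y ≈ 0#
  mask-*-zero true  y≈0 = trans (*-congˡ (y≈0 tt)) (zeroʳ _)
  mask-*-zero false _   = zeroˡ _

  sum-mask-scalar : (P : Fin k → Bool) (f : Fin k → K) (g : Fin k → 𝔽) →
                    (∀ t → T (P t) → f t ≈ scalar (g t)) → sum (λ t → mask (P t) (f t)) ≈ scalar (sumOn P g)
  sum-mask-scalar P f g f≈g =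
    trans (sum-cong-≋ (λ t → term (P t) (f≈g t))) (sym (scalar-sumF (λ t → if P t then g t else 0F)))
    where
    term : ∀ b {x c} → (T b → x ≈ scalar c) → mask b x ≈ scalar (if b then c else 0F)
    term true  x≈c = x≈c tt
    term false _   = sym scalar-0

  blockInv : Fin k → Fin k → K
  blockInv j t = mask (InBlock (blk j) t) (scalar (B (blk j) j t))

  IsPoly-blockInv : ∀ j t → IsPoly (blockInv j t)
  IsPoly-blockInv j t with InBlock (blk j) t
  ... | true  = IsPoly-scalar _
  ... | false = IsPoly-0

  blockInv-column : ∀ j i → blockInv j i ≈ mask (InBlock (blk i) j) (scalar (B (blk i) j i))
  blockInv-column j i with blk i Fin.≟ blk j | blk j Fin.≟ blk i
  ... | yes i~j | yes _   = reflexive (≡.cong (λ ℓ → scalar (B ℓ j i)) (≡.sym i~j))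
  ... | no  _   | no  _   = refl
  ... | yes i~j | no  j≁i = ⊥-elim (j≁i (≡.sym i~j))
  ... | no  i≁j | yes j~i = ⊥-elim (i≁j (≡.sym j~i))

  blockInv-a-diag : ∀ {j j'} → blk j ≡ blk j' → sum (λ t → blockInv j t * a t j') ≈ δK j j'
  blockInv-a-diag {j} {j'} j~j' = begin
      sum (λ t → blockInv j t * a t j')
    ≈⟨ sum-cong-≋ (λ t → mask-*ˡ (InBlock ℓ t) (scalar (B ℓ j t)) (a t j')) ⟩
      sum (λ t → mask (InBlock ℓ t) (scalar (B ℓ j t) * a t j'))
    ≈⟨ sum-mask-scalar (InBlock ℓ) _ (λ t → B ℓ j t *F A t j') entries ⟩
      scalar (sumOn (InBlock ℓ) (λ t → B ℓ j t *F A t j'))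
    ≈⟨ scalar-cong (proj₂ (proj₂ (a-diag-inv ℓ) j j' (≡⇒InBlock ≡.refl) (≡⇒InBlock (≡.sym j~j')))) ⟩
      δK j j' ∎
    where
    ℓ = blk j
    entries : ∀ t → T (InBlock ℓ t) → scalar (B ℓ j t) * a t j' ≈ scalar (B ℓ j t *F A t j')
    entries t t∈ℓ = trans (*-congˡ (a≈A (≡.trans (InBlock⇒≡ t∈ℓ) j~j'))) (sym (scalar-* _ _))

  a-blockInv-diag : ∀ {i' i} → blk i' ≡ blk i → sum (λ j → a i' j * blockInv j i) ≈ δK i' i
  a-blockInv-diag {i'} {i} i'~i = begin
      sum (λ j → a i' j * blockInv j i)
    ≈⟨ sum-cong-≋ (λ j → trans (*-congˡ (blockInv-column j i))
                               (mask-*ʳ (InBlock ℓ j) (scalar (B ℓ j i)) (a i' j))) ⟩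
      sum (λ j → mask (InBlock ℓ j) (a i' j * scalar (B ℓ j i)))
    ≈⟨ sum-mask-scalar (InBlock ℓ) _ (λ j → A i' j *F B ℓ j i) entries ⟩
      scalar (sumOn (InBlock ℓ) (λ j → A i' j *F B ℓ j i))
    ≈⟨ scalar-cong (proj₁ (proj₂ (a-diag-inv ℓ) i' i (≡⇒InBlock i'~i) (≡⇒InBlock ≡.refl))) ⟩
      δK i' i ∎
    where
    ℓ = blk i
    entries : ∀ j → T (InBlock ℓ j) → a i' j * scalar (B ℓ j i) ≈ scalar (A i' j *F B ℓ j i)
    entries j j∈ℓ = trans (*-congʳ (a≈A (≡.trans i'~i (≡.sym (InBlock⇒≡ j∈ℓ))))) (sym (scalar-* _ _))

  blockInv-a-below : ∀ {j j'} → blk j' Fin.< blk j → sum (λ t → blockInv j t * a t j') ≈ 0#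
  blockInv-a-below {j} {j'} j'<j = sum-zero _ (λ t → mask-*-zero (InBlock (blk j) t)
    (λ t∈ → ⟦ a-below-zero t j' (≡.subst (blk j' Fin.<_) (≡.sym (InBlock⇒≡ t∈)) j'<j) ⟧))

  a-blockInv-above : ∀ {i' i} → blk i Fin.< blk i' → sum (λ j → a i' j * blockInv j i) ≈ 0#
  a-blockInv-above {i'} {i} i<i' = sum-zero _ (λ j → trans (*-comm (a i' j) (blockInv j i))
    (trans (*-congʳ (blockInv-column j i)) (mask-*-zero (InBlock (blk i) j)
      (λ j∈ → ⟦ a-below-zero i' j (≡.subst (Fin._< blk i') (≡.sym (InBlock⇒≡ j∈)) i<i') ⟧))))

  -- blockInv · a is block upper unitriangular, so a c = 0 forces c = 0, block by block from the top.
  kernel-trivial : ∀ (c : Fin k → K) → (∀ i → sum (λ j → a i j * c j) ≈ 0#) → ∀ j → c j ≈ 0#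
  kernel-trivial c ac≈0 = descending-blocks (λ j → c j ≈ 0#) step
    where
    step : ∀ j → (∀ {j'} → blk j Fin.< blk j' → c j' ≈ 0#) → c j ≈ 0#
    step j higher≈0 = begin
        c j
      ≈⟨ sym (sum-δˡ c j) ⟩
        sum (λ j' → δK j j' * c j')
      ≈⟨ sum-cong-≋ (λ j' → sym (row j')) ⟩
        sum (λ j' → sum (λ t → blockInv j t * a t j') * c j')
      ≈⟨ sym (sum-*-sum (blockInv j) a c) ⟩
        sum (λ t → blockInv j t * sum (λ j' → a t j' * c j'))
      ≈⟨ sum-zero _ (λ t → trans (*-congˡ (ac≈0 t)) (zeroʳ _)) ⟩
        0# ∎
      where
      row : ∀ j' → sum (λ t → blockInv j t * a t j') * c j' ≈ δK j j' * c j'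
      row j' with FinP.<-cmp (blk j') (blk j)
      ... | tri< j'<j _ _ = *-congʳ (trans (blockInv-a-below j'<j)
                                           (sym (δK-offdiag (<-blocks⇒≢ j'<j))))
      ... | tri≈ _ j'~j _ = *-congʳ (blockInv-a-diag (≡.sym j'~j))
      ... | tri> _ _ j<j' = trans (*-congˡ (higher≈0 j<j'))
                              (trans (zeroʳ _) (sym (trans (*-congˡ (higher≈0 j<j')) (zeroʳ _))))

  module Columns {n} (v : Fin k → Vec n) where

    u : Fin k → Vec n
    u j = lin (λ i → a i j) v

    u-LinIndepK : LinIndepK v → LinIndepK u
    u-LinIndepK v-indep c Σcu≈0 j = ≋⇒≈K (kernel-trivial c ac≈0 j)
      where
      Σ≈0 : VZero (lin (λ i → sum (λ j → c j * a i j)) v)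
      Σ≈0 coord = ≋⇒≈K (begin
          lin (λ i → sum (λ j → c j * a i j)) v coord
        ≈⟨ sym (lin-lin c (λ j i → a i j) v coord) ⟩
          lin c u coord
        ≈⟨ ⟦ Σcu≈0 coord ⟧ ⟩
          0# ∎)
      ac≈0 : ∀ i → sum (λ j → a i j * c j) ≈ 0#
      ac≈0 i = trans (sum-cong-≋ (λ j → *-comm (a i j) (c j))) ⟦ v-indep _ Σ≈0 i ⟧

    -- a · blockInv is block upper unitriangular, so v i is a combination of u and of the v i'
    -- from strictly lower blocks, which lie in ⟨u⟩ by induction.
    v∈⟨u⟩ : ∀ i → InLat u (v i)
    v∈⟨u⟩ = ascending-blocks (λ i → InLat u (v i)) step
      where
      step : ∀ i → (∀ {i'} → blk i' Fin.< blk i → InLat u (v i')) → InLat u (v i)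
      step i lower∈⟨u⟩ =
        InLat-resp v≈ (InLat-+ (InLat-lin (λ j → IsPoly-blockInv j i) (inj₂ ∘ InLat-basis u))
                               (InLat-lin ρ-poly ρ-cases))
        where
        D : Fin k → K
        D i' = sum (λ j → a i' j * blockInv j i)
        ρ : Fin k → K
        ρ i' = - D i' + δK i' i
        ρ-poly : ∀ i' → IsPoly (ρ i')
        ρ-poly i' = IsPoly-⊕ (IsPoly-⊖ {D i'} (IsPoly-sum (λ j → IsPoly-⊗ (a-poly i' j) (IsPoly-blockInv j i))))
                             (IsPoly-scalar _)
        ρ-cases : ∀ i' → ρ i' ≈ 0# ⊎ InLat u (v i')
        ρ-cases i' with FinP.<-cmp (blk i') (blk i)
        ... | tri< i'<i _ _ = inj₂ (lower∈⟨u⟩ i'<i)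
        ... | tri≈ _ i'~i _ = inj₁ (trans (+-congʳ (-‿cong (a-blockInv-diag i'~i))) (-‿inverseˡ _))
        ... | tri> _ _ i<i' = inj₁ (trans (+-cong (trans (-‿cong (a-blockInv-above i<i')) -0#≈0#)
                                                 (δK-offdiag (<-blocks⇒≢ i<i')))
                                          (+-identityˡ 0#))
        v≈ : ∀ coord → v i coord ≈ lin (λ j → blockInv j i) u coord + lin ρ v coord
        v≈ coord = begin
            v i coord
          ≈⟨ sym (lin-δʳ v i coord) ⟩
            lin (λ i' → δK i' i) v coord
          ≈⟨ lin-cong {x = v} {y = v} (λ i' _ → *-congʳ (sym (\\-leftDividesˡ (D i') (δK i' i)))) coord ⟩
            lin (λ i' → D i' + ρ i') v coord
          ≈⟨ lin-+ D ρ v coord ⟩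
            lin D v coord + lin ρ v coord
          ≈⟨ +-congʳ (sym (lin-cong {x = v} {y = v}
                               (λ i' _ → *-congʳ (sum-cong-≋ (λ j → *-comm (blockInv j i) (a i' j)))) coord)) ⟩
            lin (λ i' → sum (λ j → blockInv j i * a i' j)) v coord + lin ρ v coord
          ≈⟨ +-congʳ (sym (lin-lin (λ j → blockInv j i) (λ j i' → a i' j) v coord)) ⟩
            lin (λ j → blockInv j i) u coord + lin ρ v coord ∎

module SuccessiveMinimaBlocks (F : FiniteField) {k m : ℕ}
  (e : Fin m → ℤ) (e-mono : ∀ ℓ ℓ' → ℓ Fin.< ℓ' → e ℓ ℤ.< e ℓ')
  (lam : Fin k → ℤ) (blk : Fin k → Fin m) (lam≡e∘blk : ∀ i → lam i ≡ e (blk i)) where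
  open FiniteField F using () renaming (Carrier to 𝔽; _≈_ to _≈F_; _*_ to _*F_; _+_ to _+F_)
  open LS F
  open LaurentSeriesRing F
  open LinearAlgebraOverK F
  open CommutativeRing Kring hiding (zero)

  e-injective : ∀ {ℓ ℓ'} → e ℓ ≡ e ℓ' → ℓ ≡ ℓ'
  e-injective {ℓ} {ℓ'} eq with FinP.<-cmp ℓ ℓ'
  ... | tri< ℓ<ℓ' _ _ = ⊥-elim (ℤP.<-irrefl eq (e-mono ℓ ℓ' ℓ<ℓ'))
  ... | tri≈ _ ℓ≡ℓ' _ = ℓ≡ℓ'
  ... | tri> _ _ ℓ'<ℓ = ⊥-elim (ℤP.<-irrefl (≡.sym eq) (e-mono ℓ' ℓ ℓ'<ℓ))

  InI≡InBlock : ∀ ℓ j → InI lam e ℓ j ≡ does (blk j Fin.≟ ℓ)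
  InI≡InBlock ℓ j with lam j ℤ.≟ e ℓ | blk j Fin.≟ ℓ
  ... | yes _  | yes _  = ≡.refl
  ... | no  _  | no  _  = ≡.refl
  ... | yes λ≡ | no  b≢ = ⊥-elim (b≢ (e-injective (≡.trans (≡.sym (lam≡e∘blk j)) λ≡)))
  ... | no  λ≢ | yes b≡ = ⊥-elim (λ≢ (≡.trans (lam≡e∘blk j) (≡.cong e b≡)))

  sumOn-resp : ∀ {k} {P Q : Fin k → Bool} (f : Fin k → 𝔽) → (∀ t → P t ≡ Q t) → sumOn P f ≡ sumOn Q f
  sumOn-resp {zero}  f P≡Q = ≡.refl
  sumOn-resp {suc k} f P≡Q = ≡.cong₂ _+F_ (≡.cong (λ b → if b then f Fin.zero else _) (P≡Q Fin.zero))
                                         (sumOn-resp (f ∘ Fin.suc) (P≡Q ∘ Fin.suc))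

  InvertibleOn-resp : ∀ {k} {P Q : Fin k → Bool} {M : Fin k → Fin k → 𝔽} → (∀ t → P t ≡ Q t) →
                      InvertibleOn P M → InvertibleOn Q M
  InvertibleOn-resp {P = P} {Q} {M} P≡Q (N , inverse) = N , λ i j i∈Q j∈Q →
    let i∈P = ≡.subst T (≡.sym (P≡Q i)) i∈Q
        j∈P = ≡.subst T (≡.sym (P≡Q j)) j∈Q
    in ≡.subst (_≈F δ i j) (sumOn-resp (λ t → M i t *F N t j) P≡Q) (proj₁ (inverse i j i∈P j∈P))
     , ≡.subst (_≈F δ i j) (sumOn-resp (λ t → N i t *F M t j) P≡Q) (proj₂ (inverse i j i∈P j∈P))

  module _ (a : Fin k → Fin k → K) where

    Cond1⇒diag-const : Cond1 lam e a → ∀ i j → blk i ≡ blk j → AbsLe (a i j) 0ℤ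
    Cond1⇒diag-const c1 i j i~j = c1 (blk j) i j (≡.trans (lam≡e∘blk i) (≡.cong e i~j)) (lam≡e∘blk j)

    Cond3⇒below-zero : Cond3 lam e a → ∀ i j → blk j Fin.< blk i → a i j ≈K 0K
    Cond3⇒below-zero c3 i j j<i = c3 (blk j) (blk i) j<i i j (lam≡e∘blk i) (lam≡e∘blk j)

    Cond4⇒diag-inv : Cond4 lam e a →
                     ∀ ℓ → InvertibleOn (λ j → does (blk j Fin.≟ ℓ)) (λ i j → const (a i j))
    Cond4⇒diag-inv c4 ℓ = InvertibleOn-resp (InI≡InBlock ℓ) (c4 ℓ)

    column-NormLe : ∀ {n} {v : Fin k → Vec n} → Cond1 lam e a → Cond2 lam e a → Cond3 lam e a →
                    (∀ i → NormLe (v i) (lam i)) → ∀ j → NormLe (lin (λ i → a i j) v) (lam j)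
    column-NormLe {v = v} c1 c2 c3 v≤λ j = NormLe-lin term
      where
      open import Data.Integer.Tactic.RingSolver using (solve-∀)
      cancel : ∀ (x y : ℤ) → (x ℤ.- y) ℤ.+ y ≡ x
      cancel = solve-∀
      term : ∀ i coord → AbsLe (a i j * v i coord) (lam j)
      term i coord with FinP.<-cmp (blk i) (blk j)
      ... | tri< i<j _ _ = AbsLe-mono {a i j * v i coord} (ℤP.≤-reflexive exponents)
          (AbsLe-⊗ (c2 (blk i) (blk j) i<j i j (lam≡e∘blk i) (lam≡e∘blk j)) (v≤λ i coord))
        where
        exponents : (e (blk j) ℤ.- e (blk i)) ℤ.+ lam i ≡ lam j
        exponents = ≡.trans (≡.cong (λ x → (e (blk j) ℤ.- e (blk i)) ℤ.+ x) (lam≡e∘blk i))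
                            (≡.trans (cancel (e (blk j)) (e (blk i))) (≡.sym (lam≡e∘blk j)))
      ... | tri≈ _ i~j _ = AbsLe-mono {a i j * v i coord} (ℤP.≤-reflexive exponents)
          (AbsLe-⊗ (Cond1⇒diag-const c1 i j i~j) (v≤λ i coord))
        where
        exponents : 0ℤ ℤ.+ lam i ≡ lam j
        exponents = ≡.trans (ℤP.+-identityˡ (lam i))
                            (≡.trans (lam≡e∘blk i) (≡.trans (≡.cong e i~j) (≡.sym (lam≡e∘blk j))))
      ... | tri> _ _ j<i = AbsLe-resp (sym (trans (*-congʳ ⟦ Cond3⇒below-zero c3 i j j<i ⟧) (zeroˡ (v i coord))))
                                      (AbsLe-0 (lam j))

proposition5p3 : (F : FiniteField) → let open LS F in
    ∀ {n k m} → 1 ≤ k → k ≤ n → 1 ≤ m →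
    (e : Fin m → ℤ) → (∀ j j' → j Fin.< j' → e j < e j') →
    (s : Fin m → ℕ) →
    (w : Fin k → Vec n) → LinIndepK w →
    (lam : Fin k → ℤ) → (∀ i → IsSuccMin w i (lam i)) → IsMuS lam e s →
    (v : Fin k → Vec n) → IsRBasis w v → (∀ i → NormEq (v i) (lam i)) →
    (a : Fin k → Fin k → K) → (∀ i j → IsPoly (a i j)) →
    Cond1 lam e a → Cond2 lam e a → Cond3 lam e a → Cond4 lam e a →
    IsRBasis w (λ j → lin (λ i → a i j) v)
      × (∀ j → NormEq (lin (λ i → a i j) v) (lam j))
proposition5p3 F {n} {k} {m} _ _ _ e e-mono _ w w-indep lam λ-min μs v v-basis v-norm a a-poly c1 c2 c3 c4 =
  (u∈Λ , Λ⊆⟨u⟩ , LinIndepK⇒LinIndepR u-indep) ,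
  λ j → u≤λ j , succMin-lowerBound λ-min u-indep u∈Λ u≤λ j
  where
  open LS F
  open LinearAlgebraOverK F
  blk : Fin k → Fin m
  blk i = proj₁ (proj₁ μs i)
  open SuccessiveMinimaBlocks F e e-mono lam blk (λ i → proj₂ (proj₁ μs i))
  open BlockTriangular F blk a a-poly (Cond3⇒below-zero a c3) (Cond1⇒diag-const a c1) (Cond4⇒diag-inv a c4)
  open Columns v
  u-indep : LinIndepK u
  u-indep = u-LinIndepK (IsRBasis⇒LinIndepK w-indep v-basis)
  u∈Λ : ∀ j → InLat w (u j)
  u∈Λ j = InLat-lin (λ i → a-poly i j) (inj₂ ∘ proj₁ v-basis)
  Λ⊆⟨u⟩ : ∀ x → InLat w x → InLat u x
  Λ⊆⟨u⟩ x x∈Λ = InLat-trans {p = x} v∈⟨u⟩ (proj₁ (proj₂ v-basis) x x∈Λ)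
  u≤λ : ∀ j → NormLe (u j) (lam j)
  u≤λ = column-NormLe a c1 c2 c3 (proj₁ ∘ v-norm)
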